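{- Let $L$ be a justification logic and $CS$ a coherent constant specification for $L$. Suppose that whenever $L+CS\vdash r:A\wedge s:B$ for terms $r,s$ and formulas $A,B$, there is a justification term $t$ with $L+CS\vdash t:(A\wedge B)$. Then every finite subset of $\mathrm{OK}(CS)=\{E:\exists t,\ L+CS\vdash t:E\}$ is satisfiable in some modular model of $\mathrm{JL}$ with the same language as $L$.
   Context: A justification logic $L$ is a Hilbert system (rule: modus ponens) over a language whose formulas are built from propositional variables, $\bot$ and Boolean connectives together with formulas $t:A$ for justification terms $t$ (built from justification constants and variables by binary operations including $\cdot$ and $+$), containing classical propositional axioms and the Application axiom $s:(P\to Q)\to(t:P\to[s\cdot t]:Q)$ and Sum axioms $s:P\to[s+t]:P$, $t:P\to[s+t]:P$. A (possibly negative) constant specification $CS$ is a set of formulas of the form $e_1:\cdots:e_n:P$ or their negations ($e_i$ constants) with $L+CS$ consistent; $L+CS\vdash\varphi$ means derivable from the axioms of $L$ and $CS$ with modus ponens. A modular model of $\mathrm{JL}$ over this language is a pair of maps $*:\mathbf{Var}\to\{0,1\}$, $*:\mathbf{Tm}\to\mathcal P(\mathbf{Fm})$ with $s^*\cdot t^*\subseteq[s\cdot t]^*$ and $s^*\cup t^*\subseteq[s+t]^*$, where $X\cdot Y=\{Q:(P\to Q)\in X,P\in Y\}$; truth is classical on connectives, $\bot$ false, $t:P$ true iff $P\in t^*$. $CS$ is coherent if for every formula $E$ and term $t$ with $L+CS\vdash t:E$ there exists a modular model of $\mathrm{JL}$ (same language as $L$) in which $E$ is true. -}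

module Defs where

open import Data.Bool using (Bool; true; false; _∧_; _∨_; not)
open import Data.Product using (Σ; ∃; _×_; _,_)
open import Data.Empty using (⊥)
open import Relation.Binary.PropositionalEquality using (_≡_)
open import Relation.Nullary using (¬_)

record Language : Set₁ where
  field
    PVar  : Set
    Const : Set
    JVar  : Set
    Op    : Set

module _ (𝓛 : Language) where
  open Language 𝓛

  infixl 7 _·_
  infixl 6 _+ₜ_
  data Tm : Set where
    con   : Const → Tm
    var   : JVar → Tm
    _·_   : Tm → Tm → Tm
    _+ₜ_  : Tm → Tm → Tm
    op    : Op → Tm → Tm → Tm

  infixr 4 _⇒_
  infixr 5 _∨ᶠ_
  infixr 6 _∧ᶠ_
  infix  8 _∶_
  data Fm : Set where
    atom  : PVar → Fm
    ⊥ᶠ    : Fm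
    _⇒_   : Fm → Fm → Fm
    _∧ᶠ_  : Fm → Fm → Fm
    _∨ᶠ_  : Fm → Fm → Fm
    _∶_   : Tm → Fm → Fm

  ¬ᶠ_ : Fm → Fm
  ¬ᶠ A = A ⇒ ⊥ᶠ

  evalB : (PVar → Bool) → (Tm → Fm → Bool) → Fm → Bool
  evalB ν μ (atom p)  = ν p
  evalB ν μ ⊥ᶠ        = false
  evalB ν μ (A ⇒ B)   = not (evalB ν μ A) ∨ evalB ν μ B
  evalB ν μ (A ∧ᶠ B)  = evalB ν μ A ∧ evalB ν μ B
  evalB ν μ (A ∨ᶠ B)  = evalB ν μ A ∨ evalB ν μ B
  evalB ν μ (t ∶ A)   = μ t A

  Tautology : Fm → Set
  Tautology A = ∀ (ν : PVar → Bool) (μ : Tm → Fm → Bool) → evalB ν μ A ≡ true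

  record JLogic : Set₁ where
    field
      Ax      : Fm → Set
      taut    : ∀ A → Tautology A → Ax A
      appl    : ∀ s t P Q → Ax (s ∶ (P ⇒ Q) ⇒ (t ∶ P ⇒ (s · t) ∶ Q))
      sumˡ    : ∀ s t P → Ax (s ∶ P ⇒ (s +ₜ t) ∶ P)
      sumʳ    : ∀ s t P → Ax (t ∶ P ⇒ (s +ₜ t) ∶ P)

  data _+_⊢_ (L : JLogic) (CS : Fm → Set) : Fm → Set where
    ax : ∀ {A} → JLogic.Ax L A → L + CS ⊢ A
    cs : ∀ {A} → CS A → L + CS ⊢ A
    mp : ∀ {A B} → L + CS ⊢ (A ⇒ B) → L + CS ⊢ A → L + CS ⊢ B

  data ConstChain : Fm → Set where
    one  : ∀ e P → ConstChain (con e ∶ P)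
    more : ∀ e {A} → ConstChain A → ConstChain (con e ∶ A)

  data CSShape : Fm → Set where
    pos : ∀ {A} → ConstChain A → CSShape A
    neg : ∀ {A} → ConstChain A → CSShape (¬ᶠ A)

  record IsConstSpec (L : JLogic) (CS : Fm → Set) : Set where
    field
      shape      : ∀ A → CS A → CSShape A
      consistent : ¬ (L + CS ⊢ ⊥ᶠ)

  -- Modular models of JL; a set of formulas is rendered as its
  -- characteristic function Fm → Bool.
  record ModularModel : Set where
    field
      val   : PVar → Bool
      tmI   : Tm → Fm → Bool
      app⊆  : ∀ s t P Q → tmI s (P ⇒ Q) ≡ true → tmI t P ≡ true →
              tmI (s · t) Q ≡ true
      sumˡ⊆ : ∀ s t P → tmI s P ≡ true → tmI (s +ₜ t) P ≡ true
      sumʳ⊆ : ∀ s t P → tmI t P ≡ true → tmI (s +ₜ t) P ≡ true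

  _⊨_ : ModularModel → Fm → Bool
  M ⊨ A = evalB (ModularModel.val M) (ModularModel.tmI M) A

  Coherent : JLogic → (Fm → Set) → Set
  Coherent L CS = ∀ (E : Fm) (t : Tm) → L + CS ⊢ (t ∶ E) →
                  Σ ModularModel (λ M → (M ⊨ E) ≡ true)

  OK : JLogic → (Fm → Set) → Fm → Set
  OK L CS E = ∃ (λ (t : Tm) → L + CS ⊢ (t ∶ E))

-- An OK-formula E comes with a derivation of t:E, and coherence gives a model of E.
-- Closure under conjunction turns finitely many such formulas E₁,…,Eₙ into one,
-- t:(E₁ ∧ … ∧ Eₙ), so coherence applied to the conjunction yields a common model.
module Submission where

open import Defs
open import Data.List using (List; []; _∷_)
open import Data.List.Relation.Unary.All using (All; []; _∷_)
open import Data.Product using (Σ; ∃; _×_; _,_)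
open import Data.Bool using (true; false; not; _∧_; _∨_)
open import Relation.Binary.PropositionalEquality using (_≡_; refl)

∧≡true⇒≡true×≡true : ∀ {a b} → a ∧ b ≡ true → a ≡ true × b ≡ true
∧≡true⇒≡true×≡true {true} {true} refl = refl , refl

not∨not∨∧≡true : ∀ a b → not a ∨ (not b ∨ (a ∧ b)) ≡ true
not∨not∨∧≡true true  true  = refl
not∨not∨∧≡true true  false = refl
not∨not∨∧≡true false _     = refl

module _ (𝓛 : Language) where

  trivialModel : ModularModel 𝓛
  trivialModel = record
    { val   = λ _ → false
    ; tmI   = λ _ _ → true
    ; app⊆  = λ _ _ _ _ _ _ → refl
    ; sumˡ⊆ = λ _ _ _ _ → refl
    ; sumʳ⊆ = λ _ _ _ _ → refl
    }

  -- Non-empty: OK need not contain a tautology to serve as the empty conjunction.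
  ⋀⁺ : Fm 𝓛 → List (Fm 𝓛) → Fm 𝓛
  ⋀⁺ E []        = E
  ⋀⁺ E (F ∷ Es) = E ∧ᶠ ⋀⁺ F Es

  ⊨-⋀⁺ : (M : ModularModel 𝓛) → ∀ E Es → _⊨_ 𝓛 M (⋀⁺ E Es) ≡ true →
         All (λ F → _⊨_ 𝓛 M F ≡ true) (E ∷ Es)
  ⊨-⋀⁺ M E []       ⊨E = ⊨E ∷ []
  ⊨-⋀⁺ M E (F ∷ Es) ⊨E∧Fs with ∧≡true⇒≡true×≡true {_⊨_ 𝓛 M E} ⊨E∧Fs
  ... | ⊨E , ⊨Fs = ⊨E ∷ ⊨-⋀⁺ M F Es ⊨Fs

  module _ (L : JLogic 𝓛) (CS : Fm 𝓛 → Set) where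

    ⊢-∧-intro : ∀ {A B} → _+_⊢_ 𝓛 L CS A → _+_⊢_ 𝓛 L CS B →
                _+_⊢_ 𝓛 L CS (A ∧ᶠ B)
    ⊢-∧-intro {A} {B} ⊢A ⊢B = mp (mp (ax (JLogic.taut L _ A⇒B⇒A∧B)) ⊢A) ⊢B
      where
      A⇒B⇒A∧B : Tautology 𝓛 (A ⇒ B ⇒ A ∧ᶠ B)
      A⇒B⇒A∧B ν μ = not∨not∨∧≡true (evalB 𝓛 ν μ A) (evalB 𝓛 ν μ B)

    JustifiesConjunctions : Set
    JustifiesConjunctions = ∀ (r s : Tm 𝓛) (A B : Fm 𝓛) →
      _+_⊢_ 𝓛 L CS ((r ∶ A) ∧ᶠ (s ∶ B)) →
      ∃ (λ (t : Tm 𝓛) → _+_⊢_ 𝓛 L CS (t ∶ (A ∧ᶠ B)))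

    OK-∧ : JustifiesConjunctions → ∀ {A B} →
           OK 𝓛 L CS A → OK 𝓛 L CS B → OK 𝓛 L CS (A ∧ᶠ B)
    OK-∧ justify {A} {B} (r , ⊢r∶A) (s , ⊢s∶B) =
      justify r s A B (⊢-∧-intro ⊢r∶A ⊢s∶B)

    OK-⋀⁺ : JustifiesConjunctions → ∀ {E Es} →
            OK 𝓛 L CS E → All (OK 𝓛 L CS) Es → OK 𝓛 L CS (⋀⁺ E Es)
    OK-⋀⁺ justify okE []           = okE
    OK-⋀⁺ justify okE (okF ∷ okEs) = OK-∧ justify okE (OK-⋀⁺ justify okF okEs)

corollary3p3 : (𝓛 : Language) (L : JLogic 𝓛) (CS : Fm 𝓛 → Set) →
    IsConstSpec 𝓛 L CS →
    Coherent 𝓛 L CS →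
    (∀ (r s : Tm 𝓛) (A B : Fm 𝓛) →
      _+_⊢_ 𝓛 L CS ((r ∶ A) ∧ᶠ (s ∶ B)) →
      ∃ (λ (t : Tm 𝓛) → _+_⊢_ 𝓛 L CS (t ∶ (A ∧ᶠ B)))) →
    ∀ (Es : List (Fm 𝓛)) → All (OK 𝓛 L CS) Es →
      Σ (ModularModel 𝓛) (λ M → All (λ E → _⊨_ 𝓛 M E ≡ true) Es)
corollary3p3 𝓛 L CS _ coherent justify []       []          = trivialModel 𝓛 , []
corollary3p3 𝓛 L CS _ coherent justify (E ∷ Es) (okE ∷ okEs)
  with OK-⋀⁺ 𝓛 L CS justify okE okEs
... | t , ⊢t∶⋀ with coherent (⋀⁺ 𝓛 E Es) t ⊢t∶⋀
... | M , ⊨⋀ = M , ⊨-⋀⁺ 𝓛 M E Es ⊨⋀
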